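{- The rule of external weakening is height-preserving admissible in $\mathbf{DHS}_{PAL}$: for every DHS $G$ and dynamic sequent $X$, if $G$ has a derivation of height $h$, then $G \mid X$ has a derivation of height at most $h$.
   Context: Formulas of $\mathcal{L}_{PAL}$ are generated by $A ::= p \mid \neg A \mid (A\wedge A) \mid \Box A \mid [A]A$ from a countable set of atoms. A list of announcements is a finite (possibly empty, $\epsilon$) sequence of formulas, $\alpha\cdot A$ its extension by $A$. A sequent is $M\Rightarrow N$ ($M,N$ finite multisets); $A,\Gamma$ / $\Gamma,A$ add $A$ to antecedent / succedent. A dynamic sequent is $/\!/_{\alpha_1}\Gamma_1/\!/\cdots/\!/_{\alpha_n}\Gamma_n$ (components labelled by lists of announcements; $/\!/_\epsilon\Gamma$ written $\Gamma$); a DHS is $X_1\mid\cdots\mid X_n$ of dynamic sequents. $G\mid X/\!/_\alpha M\Rightarrow N$ denotes a DHS with a dynamic sequent having component labelled $\alpha$ equal to $M\Rightarrow N$, $X$ the rest of that dynamic sequent and $G$ the rest of the DHS (possibly empty). Calculus $\mathbf{DHS}_{PAL}$ (notation "premises / conclusion"): Axioms $G\mid X/\!/_\alpha p,M\Rightarrow N,p$. (L$\neg$) $G\mid X/\!/_\alpha M\Rightarrow N,A$ / $G\mid X/\!/_\alpha\neg A,M\Rightarrow N$; (R$\neg$) $G\mid X/\!/_\alpha A,M\Rightarrow N$ / $G\mid X/\!/_\alpha M\Rightarrow N,\neg A$; (L$\wedge$) $G\mid X/\!/_\alpha A,B,M\Rightarrow N$ / $G\mid X/\!/_\alpha A\wedge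 B,M\Rightarrow N$; (R$\wedge$) $G\mid X/\!/_\alpha M\Rightarrow N,A$ and $G\mid X/\!/_\alpha M\Rightarrow N,B$ / $G\mid X/\!/_\alpha M\Rightarrow N,A\wedge B$; (L$\Box_1$) $G\mid X/\!/_\alpha\Box A,A,M\Rightarrow N$ / $G\mid X/\!/_\alpha\Box A,M\Rightarrow N$; (R$\Box$) $G\mid X/\!/_\alpha M\Rightarrow N\mid/\!/_\alpha\Rightarrow A$ / $G\mid X/\!/_\alpha M\Rightarrow N,\Box A$; (L$\Box_2$) $G\mid X/\!/_\alpha\Box A,M\Rightarrow N\mid Y/\!/_\alpha A,P\Rightarrow Q$ / $G\mid X/\!/_\alpha\Box A,M\Rightarrow N\mid Y/\!/_\alpha P\Rightarrow Q$; (L$\Box_3$) with $\beta=B_1\cdots B_n$, $\overline{Y}=Y/\!/_{\alpha\cdot\beta}\Box A,\Delta$: premises $G\mid X/\!/_\alpha\Gamma,B_1\mid\overline{Y}$, $G\mid X/\!/_\alpha\Gamma/\!/_{\alpha\cdot B_1\cdots B_i}\Rightarrow B_{i+1}\mid\overline{Y}$ ($1\le i<n$), $G\mid X/\!/_\alpha\Gamma/\!/_{\alpha\cdot\beta}A\Rightarrow\ \mid\overline{Y}$, conclusion $G\mid X/\!/_\alpha\Gamma\mid Y/\!/_{\alpha\cdot\beta}\Box A,\Delta$; (L$[\cdot]$) $G\mid X/\!/_\alpha M\Rightarrow N,A/\!/_{\alpha\cdot A}M'\Rightarrow N'$ and $G\mid X/\!/_\alpha M\Rightarrow N/\!/_{\alpha\cdot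 A}B,M'\Rightarrow N'$ / $G\mid X/\!/_\alpha[A]B,M\Rightarrow N/\!/_{\alpha\cdot A}M'\Rightarrow N'$; (R$[\cdot]$) $G\mid X/\!/_\alpha A,M\Rightarrow N/\!/_{\alpha\cdot A}M'\Rightarrow N',B$ / $G\mid X/\!/_\alpha M\Rightarrow N,[A]B/\!/_{\alpha\cdot A}M'\Rightarrow N'$ (in both, if no $\alpha\cdot A$ component is in the conclusion, the premises — for (L$[\cdot]$) the right one — contain a new component $/\!/_{\alpha\cdot A}$ with $M',N'$ empty); (Lat) $G\mid X/\!/_\alpha p,M\Rightarrow N/\!/_{\alpha\cdot A}p,M'\Rightarrow N'$ / $G\mid X/\!/_\alpha M\Rightarrow N/\!/_{\alpha\cdot A}p,M'\Rightarrow N'$; (Rat) $G\mid X/\!/_\alpha M\Rightarrow N,p/\!/_{\alpha\cdot A}M'\Rightarrow N',p$ / $G\mid X/\!/_\alpha M\Rightarrow N/\!/_{\alpha\cdot A}M'\Rightarrow N',p$; (New) $G\mid X/\!/_\alpha\Rightarrow\ /\!/_{\alpha\cdot A}M\Rightarrow N$ / $G\mid X/\!/_{\alpha\cdot A}M\Rightarrow N$; (Recall) $G\mid X/\!/_\alpha A,M\Rightarrow N/\!/_{\alpha\cdot A}M'\Rightarrow N'$ / $G\mid X/\!/_\alpha M\Rightarrow N/\!/_{\alpha\cdot A}M'\Rightarrow N'$. Derivations and their heights are defined as usual. -}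

module Defs where

open import Data.Nat using (ℕ; zero; suc; _⊔_)
open import Data.List using (List; []; _∷_; _++_; _∷ʳ_; [_])
open import Data.List.Relation.Unary.All using (All)
open import Data.Product using (_×_; _,_; proj₁)
open import Relation.Binary.PropositionalEquality using (_≡_; _≢_)
open import Data.List.Relation.Binary.Permutation.Homogeneous using (Permutation)
open import Data.List.Relation.Binary.Permutation.Propositional using (_↭_)

infixr 30 ~_ □_
infixr 25 ⟦_⟧_
infixr 20 _∧_

data Fm : Set where
  at   : ℕ → Fm
  ~_   : Fm → Fm
  _∧_  : Fm → Fm → Fm
  □_   : Fm → Fm
  ⟦_⟧_ : Fm → Fm → Fm

-- Lists of announcements: α · A  is  α ∷ʳ A ,  α · β  is  α ++ β
Ann : Set
Ann = List Fm

-- Sequents M ⇒ N (multisets represented as lists, identified up to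
-- permutation), labelled components, dynamic sequents, DHSs.

infix 4.5 _⇒_
record Seq : Set where
  constructor _⇒_
  field
    ant : List Fm
    succ : List Fm

Comp : Set
Comp = Ann × Seq

DSeq : Set
DSeq = List Comp

DHS : Set
DHS = List DSeq

label : Comp → Ann
label = proj₁

data _≈C_ : Comp → Comp → Set where
  ≈c : ∀ {α M M' N N'} → M ↭ M' → N ↭ N' → (α , M ⇒ N) ≈C (α , M' ⇒ N')

_≈D_ : DSeq → DSeq → Set
_≈D_ = Permutation _≈C_

_≈_ : DHS → DHS → Set
_≈_ = Permutation _≈D_

-- Auxiliary for (L□3): for β = B₁ B₂ ⋯ Bₙ,  steps [ B₁ ] (B₂ ⋯ Bₙ)
-- lists the pairs (B₁⋯Bᵢ , Bᵢ₊₁) for 1 ≤ i < n.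

steps : List Fm → List Fm → List (List Fm × Fm)
steps pre []       = []
steps pre (C ∷ Cs) = (pre , C) ∷ steps (pre ∷ʳ C) Cs

midPrems : Ann → Seq → DSeq → DSeq → DHS → List (List Fm × Fm) → List DHS
midPrems α Γ X Ybar G []             = []
midPrems α Γ X Ybar G ((pre , C) ∷ ps) =
  (((α , Γ) ∷ (α ++ pre , [] ⇒ [ C ]) ∷ X) ∷ Ybar ∷ G) ∷ midPrems α Γ X Ybar G ps

-- The active dynamic sequent(s) are written first and the active
-- component(s) first in them; arbitrary positions are obtained via the
-- multiset identification _≈_ in Deriv below.

data Rule : List DHS → DHS → Set where
  ax   : ∀ {G X α p M N} →
         Rule [] (((α , at p ∷ M ⇒ at p ∷ N) ∷ X) ∷ G)
  L¬   : ∀ {G X α A M N} →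
         Rule [ ((α , M ⇒ A ∷ N) ∷ X) ∷ G ]
              (((α , ~ A ∷ M ⇒ N) ∷ X) ∷ G)
  R¬   : ∀ {G X α A M N} →
         Rule [ ((α , A ∷ M ⇒ N) ∷ X) ∷ G ]
              (((α , M ⇒ ~ A ∷ N) ∷ X) ∷ G)
  L∧   : ∀ {G X α A B M N} →
         Rule [ ((α , A ∷ B ∷ M ⇒ N) ∷ X) ∷ G ]
              (((α , A ∧ B ∷ M ⇒ N) ∷ X) ∷ G)
  R∧   : ∀ {G X α A B M N} →
         Rule ((((α , M ⇒ A ∷ N) ∷ X) ∷ G) ∷ [ ((α , M ⇒ B ∷ N) ∷ X) ∷ G ])
              (((α , M ⇒ A ∧ B ∷ N) ∷ X) ∷ G)
  L□₁  : ∀ {G X α A M N} →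
         Rule [ ((α , □ A ∷ A ∷ M ⇒ N) ∷ X) ∷ G ]
              (((α , □ A ∷ M ⇒ N) ∷ X) ∷ G)
  R□   : ∀ {G X α A M N} →
         Rule [ ((α , M ⇒ N) ∷ X) ∷ [ (α , [] ⇒ [ A ]) ] ∷ G ]
              (((α , M ⇒ □ A ∷ N) ∷ X) ∷ G)
  L□₂  : ∀ {G X Y α A M N P Q} →
         Rule [ ((α , □ A ∷ M ⇒ N) ∷ X) ∷ ((α , A ∷ P ⇒ Q) ∷ Y) ∷ G ]
              (((α , □ A ∷ M ⇒ N) ∷ X) ∷ ((α , P ⇒ Q) ∷ Y) ∷ G)
  L□₃  : ∀ {G X Y α A B Bs M N P Q} →
         let β    = B ∷ Bs
             Ybar = (α ++ β , □ A ∷ P ⇒ Q) ∷ Y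
         in
         Rule ((((α , M ⇒ B ∷ N) ∷ X) ∷ Ybar ∷ G)
                ∷ (midPrems α (M ⇒ N) X Ybar G (steps [ B ] Bs)
                   ++ [ ((α , M ⇒ N) ∷ (α ++ β , [ A ] ⇒ []) ∷ X) ∷ Ybar ∷ G ]))
              (((α , M ⇒ N) ∷ X) ∷ Ybar ∷ G)
  L[]  : ∀ {G X α A B M N M' N'} →
         Rule ((((α , M ⇒ A ∷ N) ∷ (α ∷ʳ A , M' ⇒ N') ∷ X) ∷ G)
               ∷ [ ((α , M ⇒ N) ∷ (α ∷ʳ A , B ∷ M' ⇒ N') ∷ X) ∷ G ])
              (((α , ⟦ A ⟧ B ∷ M ⇒ N) ∷ (α ∷ʳ A , M' ⇒ N') ∷ X) ∷ G)
  L[]new : ∀ {G X α A B M N} →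
         All (λ c → label c ≢ α ∷ʳ A) X →
         Rule ((((α , M ⇒ A ∷ N) ∷ X) ∷ G)
               ∷ [ ((α , M ⇒ N) ∷ (α ∷ʳ A , [ B ] ⇒ []) ∷ X) ∷ G ])
              (((α , ⟦ A ⟧ B ∷ M ⇒ N) ∷ X) ∷ G)
  R[]  : ∀ {G X α A B M N M' N'} →
         Rule [ ((α , A ∷ M ⇒ N) ∷ (α ∷ʳ A , M' ⇒ B ∷ N') ∷ X) ∷ G ]
              (((α , M ⇒ ⟦ A ⟧ B ∷ N) ∷ (α ∷ʳ A , M' ⇒ N') ∷ X) ∷ G)
  R[]new : ∀ {G X α A B M N} →
         All (λ c → label c ≢ α ∷ʳ A) X →
         Rule [ ((α , A ∷ M ⇒ N) ∷ (α ∷ʳ A , [] ⇒ [ B ]) ∷ X) ∷ G ]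
              (((α , M ⇒ ⟦ A ⟧ B ∷ N) ∷ X) ∷ G)
  Lat  : ∀ {G X α A p M N M' N'} →
         Rule [ ((α , at p ∷ M ⇒ N) ∷ (α ∷ʳ A , at p ∷ M' ⇒ N') ∷ X) ∷ G ]
              (((α , M ⇒ N) ∷ (α ∷ʳ A , at p ∷ M' ⇒ N') ∷ X) ∷ G)
  Rat  : ∀ {G X α A p M N M' N'} →
         Rule [ ((α , M ⇒ at p ∷ N) ∷ (α ∷ʳ A , M' ⇒ at p ∷ N') ∷ X) ∷ G ]
              (((α , M ⇒ N) ∷ (α ∷ʳ A , M' ⇒ at p ∷ N') ∷ X) ∷ G)
  New  : ∀ {G X α A M N} →
         Rule [ ((α , [] ⇒ []) ∷ (α ∷ʳ A , M ⇒ N) ∷ X) ∷ G ]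
              (((α ∷ʳ A , M ⇒ N) ∷ X) ∷ G)
  Recall : ∀ {G X α A M N M' N'} →
         Rule [ ((α , A ∷ M ⇒ N) ∷ (α ∷ʳ A , M' ⇒ N') ∷ X) ∷ G ]
              (((α , M ⇒ N) ∷ (α ∷ʳ A , M' ⇒ N') ∷ X) ∷ G)

data Deriv : DHS → Set
data Derivs : List DHS → Set

data Deriv where
  by : ∀ {ps G G'} → Rule ps G → G ≈ G' → Derivs ps → Deriv G'

data Derivs where
  []  : Derivs []
  _∷_ : ∀ {P ps} → Deriv P → Derivs ps → Derivs (P ∷ ps)

height  : ∀ {G} → Deriv G → ℕ
heights : ∀ {ps} → Derivs ps → ℕ
height (by r e ds) = suc (heights ds)
heights []       = 0
heights (d ∷ ds) = height d ⊔ heights ds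

-- Weakening commutes with every rule: appending H to the conclusion and to all
-- premises of an instance of a rule of DHS_PAL gives an instance of the same rule,
-- since every rule lets the DHS context G be arbitrary. Weakening a derivation
-- node by node therefore preserves its height exactly.
module Submission where

open import Defs
open import Data.Nat using (_≤_; suc; _⊔_)
open import Data.Nat.Properties using (≤-reflexive)
open import Data.List using (List; []; _∷_; _++_; _∷ʳ_; map; [_])
open import Data.List.Properties using (map-++)
open import Data.Product using (Σ; _,_)
open import Relation.Binary.Core using (Rel)
open import Relation.Binary.Definitions using (Reflexive)
open import Relation.Binary.PropositionalEquality using (_≡_; refl; cong; cong₂; subst; sym; module ≡-Reasoning)
open import Data.List.Relation.Binary.Permutation.Homogeneous using (Permutation; refl; prep; swap; trans)
import Data.List.Relation.Binary.Pointwise as Pointwise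
import Data.List.Relation.Binary.Permutation.Propositional as ↭

≈C-refl : Reflexive _≈C_
≈C-refl {α , M ⇒ N} = ≈c ↭.↭-refl ↭.↭-refl

≈D-refl : Reflexive _≈D_
≈D-refl = refl (Pointwise.refl ≈C-refl)

Permutation-++⁺ʳ : ∀ {a r} {A : Set a} {R : Rel A r} → Reflexive R →
                   ∀ zs {xs ys} → Permutation R xs ys → Permutation R (xs ++ zs) (ys ++ zs)
Permutation-++⁺ʳ R-refl zs (refl xs∼ys)   = refl (Pointwise.++⁺ʳ R-refl zs xs∼ys)
Permutation-++⁺ʳ R-refl zs (prep e p)     = prep e (Permutation-++⁺ʳ R-refl zs p)
Permutation-++⁺ʳ R-refl zs (swap e₁ e₂ p) = swap e₁ e₂ (Permutation-++⁺ʳ R-refl zs p)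
Permutation-++⁺ʳ R-refl zs (trans p q)    =
  trans (Permutation-++⁺ʳ R-refl zs p) (Permutation-++⁺ʳ R-refl zs q)

map-++-midPrems : ∀ α Γ X Ybar G H ps →
                  map (_++ H) (midPrems α Γ X Ybar G ps) ≡ midPrems α Γ X Ybar (G ++ H) ps
map-++-midPrems α Γ X Ybar G H []       = refl
map-++-midPrems α Γ X Ybar G H (_ ∷ ps) = cong (_ ∷_) (map-++-midPrems α Γ X Ybar G H ps)

Rule-++ : ∀ {ps G} H → Rule ps G → Rule (map (_++ H) ps) (G ++ H)
Rule-++ H ax          = ax
Rule-++ H L¬          = L¬
Rule-++ H R¬          = R¬
Rule-++ H L∧          = L∧
Rule-++ H R∧          = R∧
Rule-++ H L□₁         = L□₁
Rule-++ H R□          = R□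
Rule-++ H L□₂         = L□₂
Rule-++ H (L□₃ {G} {X} {Y} {α} {A} {B} {Bs} {M} {N} {P} {Q}) =
  subst (λ qs → Rule (firstPremise ∷ qs) (((α , M ⇒ N) ∷ X) ∷ Ybar ∷ G ++ H))
        (sym weakenedPremises)
        L□₃
  where
  Ybar : DSeq
  Ybar = (α ++ B ∷ Bs , □ A ∷ P ⇒ Q) ∷ Y
  firstPremise : DHS
  firstPremise = ((α , M ⇒ B ∷ N) ∷ X) ∷ Ybar ∷ G ++ H
  mids : List DHS
  mids = midPrems α (M ⇒ N) X Ybar G (steps [ B ] Bs)
  lastPremise : DHS
  lastPremise = ((α , M ⇒ N) ∷ (α ++ B ∷ Bs , [ A ] ⇒ []) ∷ X) ∷ Ybar ∷ G

  weakenedPremises : map (_++ H) (mids ++ [ lastPremise ])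
                   ≡ midPrems α (M ⇒ N) X Ybar (G ++ H) (steps [ B ] Bs) ++ [ lastPremise ++ H ]
  weakenedPremises = begin
    map (_++ H) (mids ++ [ lastPremise ])     ≡⟨ map-++ (_++ H) mids [ lastPremise ] ⟩
    map (_++ H) mids ++ [ lastPremise ++ H ]  ≡⟨ cong (_++ [ lastPremise ++ H ]) (map-++-midPrems α (M ⇒ N) X Ybar G H (steps [ B ] Bs)) ⟩
    midPrems α (M ⇒ N) X Ybar (G ++ H) (steps [ B ] Bs) ++ [ lastPremise ++ H ] ∎
    where open ≡-Reasoning
Rule-++ H L[]         = L[]
Rule-++ H (L[]new ∉X) = L[]new ∉X
Rule-++ H R[]         = R[]
Rule-++ H (R[]new ∉X) = R[]new ∉X
Rule-++ H Lat         = Lat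
Rule-++ H Rat         = Rat
Rule-++ H New         = New
Rule-++ H Recall      = Recall

weaken  : ∀ {G} H (d : Deriv G) → Σ (Deriv (G ++ H)) (λ d' → height d' ≡ height d)
weakens : ∀ {ps} H (ds : Derivs ps) → Σ (Derivs (map (_++ H) ps)) (λ ds' → heights ds' ≡ heights ds)
weaken H (by r G≈G' ds) with weakens H ds
... | ds' , eq = by (Rule-++ H r) (Permutation-++⁺ʳ ≈D-refl H G≈G') ds' , cong suc eq
weakens H []       = [] , refl
weakens H (d ∷ ds) with weaken H d | weakens H ds
... | d' , eq | ds' , eqs = d' ∷ ds' , cong₂ _⊔_ eq eqs

mainTheorem6 : (G : DHS) (X : DSeq) (d : Deriv G) →
                 Σ (Deriv (G ∷ʳ X)) (λ d' → height d' ≤ height d)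
mainTheorem6 G X d with weaken [ X ] d
... | d' , eq = d' , ≤-reflexive eq
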